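{- For $d \geq 3$, in any $d$-set ridge cover $A_1,\dots,A_d$ of $C^d$, at least one set $A_i$ contains a pair of antipodal vertices.
   Context: $C^d=[0,1]^d$; its vertices are the points of $\{0,1\}^d$, and two vertices are antipodal iff they differ in every coordinate. A $k$-face of $C^d$ is given by a word in $\{0,1,X\}^d$ with exactly $k$ letters $X$ (the face is the set of points agreeing with the word in the non-$X$ positions). A ridge is a $(d-2)$-face. A $d$-set ridge cover of $C^d$ is a collection of $d$ sets $A_1,\dots,A_d$, each a union of ridges of $C^d$, such that every ridge is contained in at least one $A_i$. -}

module Defs where

open import Data.Nat using (ℕ; zero; suc; _+_; _∸_)
open import Data.Bool using (Bool; true; false; not)
open import Data.Fin using (Fin)
open import Data.Vec using (Vec; []; _∷_; lookup)
open import Data.Product using (Σ; _×_; _,_; ∃; proj₁)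
open import Data.Sum using (_⊎_)
open import Relation.Binary.PropositionalEquality using (_≡_; _≢_)

-- Letters of a face word: 0, 1, or X (free coordinate).
data Letter : Set where
  ℓ0 ℓ1 X : Letter

Word : ℕ → Set
Word d = Vec Letter d

countX : ∀ {d} → Word d → ℕ
countX []       = 0
countX (X ∷ w)  = suc (countX w)
countX (ℓ0 ∷ w) = countX w
countX (ℓ1 ∷ w) = countX w

Face : ℕ → ℕ → Set
Face d k = Σ (Word d) λ w → countX w ≡ k

Ridge : ℕ → Set
Ridge d = Face d (d ∸ 2)

Vertex : ℕ → Set
Vertex d = Vec Bool d

bit : Bool → Letter
bit false = ℓ0
bit true  = ℓ1

_∈F_ : ∀ {d} → Vertex d → Word d → Set
_∈F_ {d} v w = (j : Fin d) → (lookup w j ≡ X) ⊎ (lookup w j ≡ bit (lookup v j))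

Antipodal : ∀ {d} → Vertex d → Vertex d → Set
Antipodal {d} u v = (j : Fin d) → lookup u j ≢ lookup v j

-- A union of ridges, given by the family of ridges it is the union of.
RidgeUnion : ℕ → Set₁
RidgeUnion d = Ridge d → Set

_∈U_ : ∀ {d} → Vertex d → RidgeUnion d → Set
v ∈U A = ∃ λ (R : Ridge _) → A R × (v ∈F proj₁ R)

IsRidgeCover : (d : ℕ) → (Fin d → RidgeUnion d) → Set
IsRidgeCover d A = (R : Ridge d) → ∃ λ (i : Fin d) → A i R

HasAntipodalPair : ∀ {d} → RidgeUnion d → Set
HasAntipodalPair {d} A = Σ (Vertex d) λ u → Σ (Vertex d) λ v →
  Antipodal u v × u ∈U A × v ∈U A

-- Two faces with words w, w' contain antipodal vertices u ∈ w, v ∈ w' exactly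
-- when no coordinate is fixed to the same bit in both words.  Colouring every
-- ridge by the index of a set covering it, it therefore suffices to find two
-- such "opposable" ridges of the same colour in every d-colouring of the
-- ridges of C^d.  For d = 3 this is a finite search.  For d + 1, look at the
-- cylinders [0,1] × R over ridges R of C^d.  If some colour misses all of
-- them, the cylinders carry a d-colouring of the ridges of C^d, and induction
-- applies.  Otherwise fix, for every colour j, a cylinder of colour j over a
-- ridge R_j with fixed coordinates p_j < q_j.  Consider the 4d slices: the
-- ridges with x₀ = t and one further coordinate k fixed to v.  A slice of
-- colour j is not opposable to the cylinder over R_j only if k ∈ {p_j, q_j}
-- and v is R_j's value there, and two such slices with k ≠ k' are opposable
-- unless t = t'.  So (j, t xor [k = q_j]) determines a slice of colour j,
-- which injects 4d slices into 2(d + 1) < 4d keys: a contradiction.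
module Submission where

open import Defs
open import Data.Nat using (ℕ; zero; suc; _+_; _*_; _≥_; _<_; s≤s)
open import Data.Nat.Properties using (+-cancelˡ-≡; +-comm; +-suc; suc-injective; +-mono-<-≤; *-monoʳ-≤; n≤1+n; m≤m+n)
open import Data.Fin using (Fin; zero; suc; punchOut)
open import Data.Fin.Properties
  using (all?; ¬∀⟶∃¬; pigeonhole; <⇒≢; punchOut-injective; 2↔Bool; *↔×)
  renaming (_≟_ to _≟ᶠ_)
open import Data.Bool using (Bool; true; false; not; _xor_)
open import Data.Bool.Properties using (not-¬; xor-∧-commutativeRing) renaming (_≟_ to _≟ᵇ_)
open import Algebra.Bundles using (CommutativeRing)
open import Algebra.Properties.Group (CommutativeRing.+-group xor-∧-commutativeRing)
  using (∙-cancelˡ; ∙-cancelʳ)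
open import Data.Vec using ([]; _∷_; lookup; tabulate; replicate; _[_]≔_)
open import Data.Vec.Properties using (lookup∘tabulate; lookup∘update; lookup∘update′; lookup-replicate)
open import Data.List using (List; []; _∷_; map; _++_)
open import Data.List.Relation.Unary.Any using (Any; here; there; any?; satisfied)
open import Data.List.Relation.Unary.All using (All; []; _∷_)
open import Data.List.Membership.Propositional using (_∈_; lose)
open import Data.List.Membership.Propositional.Properties using (∈-map⁺; ∈-++⁺ˡ; ∈-++⁺ʳ)
open import Data.Product using (∃; ∃₂; _×_; _,_; proj₁; proj₂)
open import Data.Product.Function.NonDependent.Propositional using (_×-↔_)
open import Data.Sum using (_⊎_; inj₁; inj₂; fromInj₁)
open import Data.Empty using (⊥)
open import Function using (_∘_; _↣_; Injection)
open import Function.Construct.Composition using (_↔-∘_)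
open import Function.Construct.Identity using (↔-id)
open import Function.Properties.Inverse using (↔⇒↣; ↔-sym)
open import Relation.Nullary using (Dec; yes; no; ¬_; contradiction)
open import Relation.Nullary.Decidable using (map′; _⊎-dec_; _×-dec_; toWitness)
open import Relation.Unary using (Pred; Decidable)
open import Relation.Binary.PropositionalEquality
  using (_≡_; _≢_; refl; sym; trans; cong; cong₂; subst; module ≡-Reasoning)

private
  variable
    m n : ℕ

data Opposable : Letter → Letter → Set where
  ℓ0-ℓ1 : Opposable ℓ0 ℓ1
  ℓ1-ℓ0 : Opposable ℓ1 ℓ0
  X-any : ∀ {b} → Opposable X b
  any-X : ∀ {a} → Opposable a X

opposable? : ∀ a b → Dec (Opposable a b)
opposable? ℓ0 ℓ0 = no λ ()
opposable? ℓ0 ℓ1 = yes ℓ0-ℓ1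
opposable? ℓ0 X  = yes any-X
opposable? ℓ1 ℓ0 = yes ℓ1-ℓ0
opposable? ℓ1 ℓ1 = no λ ()
opposable? ℓ1 X  = yes any-X
opposable? X  _  = yes X-any

¬opposable⇒≡ : ∀ {a b} → ¬ Opposable a b → a ≡ b
¬opposable⇒≡ {ℓ0} {ℓ0} _ = refl
¬opposable⇒≡ {ℓ0} {ℓ1} ¬o = contradiction ℓ0-ℓ1 ¬o
¬opposable⇒≡ {ℓ0} {X}  ¬o = contradiction any-X ¬o
¬opposable⇒≡ {ℓ1} {ℓ0} ¬o = contradiction ℓ1-ℓ0 ¬o
¬opposable⇒≡ {ℓ1} {ℓ1} _ = refl
¬opposable⇒≡ {ℓ1} {X}  ¬o = contradiction any-X ¬o
¬opposable⇒≡ {X}       ¬o = contradiction X-any ¬o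

bit-injective : ∀ {x y} → bit x ≡ bit y → x ≡ y
bit-injective {false} {false} _ = refl
bit-injective {true}  {true}  _ = refl

bit≢X : ∀ x → bit x ≢ X
bit≢X false ()
bit≢X true ()

≢⇒opposable-bits : ∀ {x y} → x ≢ y → Opposable (bit x) (bit y)
≢⇒opposable-bits {false} {false} x≢y = contradiction refl x≢y
≢⇒opposable-bits {false} {true}  _   = ℓ0-ℓ1
≢⇒opposable-bits {true}  {false} _   = ℓ1-ℓ0
≢⇒opposable-bits {true}  {true}  x≢y = contradiction refl x≢y

Admits : Letter → Bool → Set
Admits a x = a ≡ X ⊎ a ≡ bit x

opposite-bits : ∀ {a b} → Opposable a b → ∃ λ x → Admits a x × Admits b (not x)
opposite-bits ℓ0-ℓ1         = false , inj₂ refl , inj₂ refl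
opposite-bits ℓ1-ℓ0         = true  , inj₂ refl , inj₂ refl
opposite-bits (X-any {ℓ0})  = true  , inj₁ refl , inj₂ refl
opposite-bits (X-any {ℓ1})  = false , inj₁ refl , inj₂ refl
opposite-bits (X-any {X})   = false , inj₁ refl , inj₁ refl
opposite-bits (any-X {ℓ0})  = false , inj₂ refl , inj₁ refl
opposite-bits (any-X {ℓ1})  = true  , inj₂ refl , inj₁ refl
opposite-bits (any-X {X})   = false , inj₁ refl , inj₁ refl

OpposableWords : Word m → Word m → Set
OpposableWords {m} w w' = (i : Fin m) → Opposable (lookup w i) (lookup w' i)

opposableWords? : (w w' : Word m) → Dec (OpposableWords w w')
opposableWords? w w' = all? λ i → opposable? (lookup w i) (lookup w' i)

opposable⇒antipodal-pair : {w w' : Word m} → OpposableWords w w' →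
  ∃₂ λ u v → Antipodal u v × u ∈F w × v ∈F w'
opposable⇒antipodal-pair {w = w} {w'} opp =
  tabulate x , tabulate (not ∘ x) , antipodal , u∈w , v∈w'
  where
  x : Fin _ → Bool
  x i = proj₁ (opposite-bits (opp i))

  antipodal : Antipodal (tabulate x) (tabulate (not ∘ x))
  antipodal j rewrite lookup∘tabulate x j | lookup∘tabulate (not ∘ x) j = not-¬ refl

  u∈w : tabulate x ∈F w
  u∈w j rewrite lookup∘tabulate x j = proj₁ (proj₂ (opposite-bits (opp j)))

  v∈w' : tabulate (not ∘ x) ∈F w'
  v∈w' j rewrite lookup∘tabulate (not ∘ x) j = proj₂ (proj₂ (opposite-bits (opp j)))

Opposableᶠ : ∀ {k} → Face m k → Face m k → Set
Opposableᶠ R R' = OpposableWords (proj₁ R) (proj₁ R')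

ℓ0∷ᶠ_ ℓ1∷ᶠ_ : ∀ {k} → Face m k → Face (suc m) k
ℓ0∷ᶠ (w , e) = ℓ0 ∷ w , e
ℓ1∷ᶠ (w , e) = ℓ1 ∷ w , e

X∷ᶠ_ : ∀ {k} → Face m k → Face (suc m) (suc k)
X∷ᶠ (w , e) = X ∷ w , cong suc e

faces : ∀ m k → List (Face m k)
faces zero    zero    = ([] , refl) ∷ []
faces zero    (suc k) = []
faces (suc m) k = map ℓ0∷ᶠ_ (faces m k) ++ map ℓ1∷ᶠ_ (faces m k) ++ free k
  where
  free : ∀ k → List (Face (suc m) k)
  free zero    = []
  free (suc k) = map X∷ᶠ_ (faces m k)

∈-faces : ∀ {k} (R : Face m k) → R ∈ faces m k
∈-faces {zero}  ([] , refl)    = here refl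
∈-faces {suc m} (ℓ0 ∷ w , e)   = ∈-++⁺ˡ (∈-map⁺ ℓ0∷ᶠ_ (∈-faces (w , e)))
∈-faces {suc m} (ℓ1 ∷ w , e)   =
  ∈-++⁺ʳ (map ℓ0∷ᶠ_ (faces m _)) (∈-++⁺ˡ (∈-map⁺ ℓ1∷ᶠ_ (∈-faces (w , e))))
∈-faces {suc m} (X ∷ w , refl) =
  ∈-++⁺ʳ (map ℓ0∷ᶠ_ (faces m _)) (∈-++⁺ʳ (map ℓ1∷ᶠ_ (faces m _)) (∈-map⁺ X∷ᶠ_ (∈-faces (w , refl))))

any-face? : ∀ {k p} {P : Pred (Face m k) p} → Decidable P → Dec (∃ P)
any-face? P? = map′ satisfied (λ (R , p) → lose (∈-faces R) p) (any? P? (faces _ _))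

module Colouring {V : Set} (E : V → V → Set) (E? : ∀ u v → Dec (E u v)) {k : ℕ} where

  MonochromaticEdge : (V → Fin k) → Set
  MonochromaticEdge c = ∃₂ λ u v → E u v × c u ≡ c v

  Clash : V → Fin k → List (V × Fin k) → Set
  Clash v i = Any λ (u , j) → E v u × j ≡ i

  -- Certificate of a backtracking search: however the vertices vs are coloured
  -- after the partial colouring a, some vertex clashes with an earlier one.
  Uncolourable : List V → List (V × Fin k) → Set
  Uncolourable []       a = ⊥
  Uncolourable (v ∷ vs) a = ∀ i → Clash v i a ⊎ Uncolourable vs ((v , i) ∷ a)

  uncolourable? : ∀ vs a → Dec (Uncolourable vs a)
  uncolourable? []       a = no λ ()
  uncolourable? (v ∷ vs) a = all? λ i →
    any? (λ (u , j) → E? v u ×-dec j ≟ᶠ i) a ⊎-dec uncolourable? vs ((v , i) ∷ a)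

  uncolourable⇒monochromatic : ∀ {vs a} → Uncolourable vs a → (c : V → Fin k) →
    All (λ (u , j) → c u ≡ j) a → MonochromaticEdge c
  uncolourable⇒monochromatic {v ∷ vs} uncol c agree with uncol (c v)
  ... | inj₂ uncol′ = uncolourable⇒monochromatic uncol′ c (refl ∷ agree)
  ... | inj₁ clash  = clash⇒monochromatic clash agree
    where
    clash⇒monochromatic : ∀ {a} → Clash v (c v) a → All (λ (u , j) → c u ≡ j) a →
                          MonochromaticEdge c
    clash⇒monochromatic (here (vu , refl)) (cu≡cv ∷ _) = v , _ , vu , sym cu≡cv
    clash⇒monochromatic (there clash)      (_ ∷ agree) = clash⇒monochromatic clash agree

open module FaceColouring {m k} =
  Colouring {V = Face m k} Opposableᶠ (λ R R' → opposableWords? (proj₁ R) (proj₁ R'))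

cube-edge-colouring-clash : (c : Ridge 3 → Fin 3) → MonochromaticEdge c
cube-edge-colouring-clash c = uncolourable⇒monochromatic {vs = faces 3 1} {a = []}
  (toWitness {a? = uncolourable? (faces 3 1) []} _) c []

#fixed : Word m → ℕ
#fixed []       = 0
#fixed (X ∷ w)  = #fixed w
#fixed (ℓ0 ∷ w) = suc (#fixed w)
#fixed (ℓ1 ∷ w) = suc (#fixed w)

countX+#fixed : (w : Word m) → countX w + #fixed w ≡ m
countX+#fixed []       = refl
countX+#fixed (X ∷ w)  = cong suc (countX+#fixed w)
countX+#fixed (ℓ0 ∷ w) = trans (+-suc (countX w) (#fixed w)) (cong suc (countX+#fixed w))
countX+#fixed (ℓ1 ∷ w) = trans (+-suc (countX w) (#fixed w)) (cong suc (countX+#fixed w))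

ridge-#fixed : (R : Ridge (2 + n)) → #fixed (proj₁ R) ≡ 2
ridge-#fixed {n} (w , countX≡n) = +-cancelˡ-≡ n _ _ (begin
  n + #fixed w         ≡⟨ cong (_+ #fixed w) (sym countX≡n) ⟩
  countX w + #fixed w  ≡⟨ countX+#fixed w ⟩
  2 + n                ≡⟨ +-comm 2 n ⟩
  n + 2                ∎)
  where open ≡-Reasoning

Fixed : Word m → Fin m → Set
Fixed w i = lookup w i ≢ X

#fixed≡0⇒X : (w : Word m) → #fixed w ≡ 0 → ∀ i → lookup w i ≡ X
#fixed≡0⇒X (X ∷ w) none zero    = refl
#fixed≡0⇒X (X ∷ w) none (suc i) = #fixed≡0⇒X w none i

#fixed≡1⇒unique : (w : Word m) → #fixed w ≡ 1 → ∀ {i j} → Fixed w i → Fixed w j → i ≡ j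
#fixed≡1⇒unique (X ∷ w)  one {zero}          fi _  = contradiction refl fi
#fixed≡1⇒unique (X ∷ w)  one {suc _} {zero}  _  fj = contradiction refl fj
#fixed≡1⇒unique (X ∷ w)  one {suc _} {suc _} fi fj = cong suc (#fixed≡1⇒unique w one fi fj)
#fixed≡1⇒unique (ℓ0 ∷ w) one {zero}  {zero}  _  _  = refl
#fixed≡1⇒unique (ℓ0 ∷ w) one {zero}  {suc j} _  fj = contradiction (#fixed≡0⇒X w (suc-injective one) j) fj
#fixed≡1⇒unique (ℓ0 ∷ w) one {suc i}         fi _  = contradiction (#fixed≡0⇒X w (suc-injective one) i) fi
#fixed≡1⇒unique (ℓ1 ∷ w) one {zero}  {zero}  _  _  = refl
#fixed≡1⇒unique (ℓ1 ∷ w) one {zero}  {suc j} _  fj = contradiction (#fixed≡0⇒X w (suc-injective one) j) fj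
#fixed≡1⇒unique (ℓ1 ∷ w) one {suc i}         fi _  = contradiction (#fixed≡0⇒X w (suc-injective one) i) fi

fixedBefore : Word m → Fin m → Bool
fixedBefore (_  ∷ w) zero    = false
fixedBefore (X  ∷ w) (suc i) = fixedBefore w i
fixedBefore (ℓ0 ∷ w) (suc i) = true
fixedBefore (ℓ1 ∷ w) (suc i) = true

#fixed≡2⇒fixedBefore-injective : (w : Word m) → #fixed w ≡ 2 → ∀ {i j} →
  Fixed w i → Fixed w j → fixedBefore w i ≡ fixedBefore w j → i ≡ j
#fixed≡2⇒fixedBefore-injective (X ∷ w)  two {zero}          fi _  _ = contradiction refl fi
#fixed≡2⇒fixedBefore-injective (X ∷ w)  two {suc _} {zero}  _  fj _ = contradiction refl fj
#fixed≡2⇒fixedBefore-injective (X ∷ w)  two {suc _} {suc _} fi fj same =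
  cong suc (#fixed≡2⇒fixedBefore-injective w two fi fj same)
#fixed≡2⇒fixedBefore-injective (ℓ0 ∷ w) two {zero}  {zero}  _  _  _ = refl
#fixed≡2⇒fixedBefore-injective (ℓ0 ∷ w) two {suc _} {suc _} fi fj _ =
  cong suc (#fixed≡1⇒unique w (suc-injective two) fi fj)
#fixed≡2⇒fixedBefore-injective (ℓ1 ∷ w) two {zero}  {zero}  _  _  _ = refl
#fixed≡2⇒fixedBefore-injective (ℓ1 ∷ w) two {suc _} {suc _} fi fj _ =
  cong suc (#fixed≡1⇒unique w (suc-injective two) fi fj)

cylinder : Ridge (2 + n) → Ridge (3 + n)
cylinder = X∷ᶠ_

cylinder-opposable : ∀ {R R' : Ridge (2 + n)} → Opposableᶠ R R' → Opposableᶠ (cylinder R) (cylinder R')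
cylinder-opposable opp zero    = X-any
cylinder-opposable opp (suc i) = opp i

countX-bit∷ : ∀ x (w : Word m) → countX (bit x ∷ w) ≡ countX w
countX-bit∷ false w = refl
countX-bit∷ true  w = refl

countX-replicate : ∀ m → countX (replicate m X) ≡ m
countX-replicate zero    = refl
countX-replicate (suc m) = cong suc (countX-replicate m)

facet : Fin (suc m) → Bool → Word (suc m)
facet k v = replicate _ X [ k ]≔ bit v

countX-facet : ∀ (k : Fin (suc m)) v → countX (facet k v) ≡ m
countX-facet {m}     zero    v = trans (countX-bit∷ v _) (countX-replicate m)
countX-facet {suc m} (suc k) v = cong suc (countX-facet k v)

lookup-facet-≢ : ∀ {k i : Fin (suc m)} v → i ≢ k → lookup (facet k v) i ≡ X
lookup-facet-≢ {i = i} v i≢k =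
  trans (lookup∘update′ i≢k (replicate _ X) (bit v)) (lookup-replicate i X)

slice : Bool → Fin (2 + n) → Bool → Ridge (3 + n)
slice t k v = bit t ∷ facet k v , trans (countX-bit∷ t _) (countX-facet k v)

slice-opposable-cylinder : ∀ t {k} v (R : Ridge (2 + n)) →
  Opposable (bit v) (lookup (proj₁ R) k) → Opposableᶠ (slice t k v) (cylinder R)
slice-opposable-cylinder t     v R opp zero = any-X
slice-opposable-cylinder t {k} v R opp (suc i) with i ≟ᶠ k
... | yes refl rewrite lookup∘update i (replicate _ X) (bit v) = opp
... | no i≢k   rewrite lookup-facet-≢ v i≢k = X-any

slices-opposable : ∀ {t t' : Bool} {k k' : Fin (2 + n)} v v' → t ≢ t' → k ≢ k' →
  Opposableᶠ (slice t k v) (slice t' k' v')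
slices-opposable v v' t≢t' k≢k' zero = ≢⇒opposable-bits t≢t'
slices-opposable {k = k} {k'} v v' t≢t' k≢k' (suc i) with i ≟ᶠ k
... | yes refl rewrite lookup-facet-≢ {k = k'} v' k≢k' = any-X
... | no i≢k   rewrite lookup-facet-≢ v i≢k = X-any

pigeonhole↣ : ∀ {a b} {A B : Set} → Fin a ↣ A → B ↣ Fin b → b < a → (f : A → B) →
  ∃₂ λ x y → x ≢ y × f x ≡ f y
pigeonhole↣ enumerate encode b<a f =
  let (i , j , i<j , same) = pigeonhole b<a (E.to ∘ f ∘ A.to)
  in A.to i , A.to j , <⇒≢ i<j ∘ A.injective , E.injective same
  where
  module A = Injection enumerate
  module E = Injection encode

module MissingColour (c : Ridge (3 + n) → Fin (3 + n)) {j} (missing : ∀ R → c (cylinder R) ≢ j) where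

  restriction : Ridge (2 + n) → Fin (2 + n)
  restriction R = punchOut (missing R ∘ sym)

  restriction-clash⇒clash : MonochromaticEdge restriction → MonochromaticEdge c
  restriction-clash⇒clash (R , R' , opp , same) =
    cylinder R , cylinder R' , cylinder-opposable {R = R} {R'} opp ,
    punchOut-injective (missing R ∘ sym) (missing R' ∘ sym) same

module EveryColourOnACylinder (c : Ridge (3 + n) → Fin (3 + n))
                              (cylinder-of : ∀ j → ∃ λ R → c (cylinder R) ≡ j) where

  base : Fin (3 + n) → Ridge (2 + n)
  base j = proj₁ (cylinder-of j)

  Slice : Set
  Slice = Fin (2 + n) × Bool × Bool

  colour : Slice → Fin (3 + n)
  colour (k , t , v) = c (slice t k v)

  slice-fixes-base : ∀ {j} ((k , t , v) : Slice) → colour (k , t , v) ≡ j →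
    MonochromaticEdge c ⊎ lookup (proj₁ (base j)) k ≡ bit v
  slice-fixes-base {j} (k , t , v) refl with opposable? (bit v) (lookup (proj₁ (base j)) k)
  ... | yes opp = inj₁ (slice t k v , cylinder (base j) , slice-opposable-cylinder t v (base j) opp ,
                        sym (proj₂ (cylinder-of j)))
  ... | no ¬opp = inj₂ (sym (¬opposable⇒≡ ¬opp))

  side : Fin (3 + n) → Slice → Bool
  side j (k , t , _) = t xor fixedBefore (proj₁ (base j)) k

  same-side⇒clash-or-≡ : ∀ {j} (s s' : Slice) → colour s ≡ j → colour s' ≡ j →
    side j s ≡ side j s' → MonochromaticEdge c ⊎ s ≡ s'
  same-side⇒clash-or-≡ {j} s@(k , t , v) s'@(k' , t' , v') cs cs' same
    with slice-fixes-base s cs | slice-fixes-base s' cs'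
  ... | inj₁ clash | _          = inj₁ clash
  ... | inj₂ _     | inj₁ clash = inj₁ clash
  ... | inj₂ fixes | inj₂ fixes' with k ≟ᶠ k' | t ≟ᵇ t'
  ...   | yes refl | _        = inj₂ (cong₂ _,_ refl (cong₂ _,_ (∙-cancelʳ _ t t' same)
                                                   (bit-injective (trans (sym fixes) fixes'))))
  ...   | no k≢k'  | yes refl = contradiction
    (#fixed≡2⇒fixedBefore-injective (proj₁ (base j)) (ridge-#fixed (base j))
      (bit≢X v ∘ trans (sym fixes)) (bit≢X v' ∘ trans (sym fixes')) (∙-cancelˡ t _ _ same)) k≢k'
  ...   | no k≢k'  | no t≢t'  = inj₁ (slice t k v , slice t' k' v' , slices-opposable v v' t≢t' k≢k' ,
                                       trans cs (sym cs'))

  key : Slice → Fin (3 + n) × Bool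
  key s = colour s , side (colour s) s

  same-key⇒clash-or-≡ : ∀ s s' → key s ≡ key s' → MonochromaticEdge c ⊎ s ≡ s'
  same-key⇒clash-or-≡ s s' same = same-side⇒clash-or-≡ s s' refl (sym same-colour)
    (trans (cong proj₂ same) (cong (λ j → side j s') (sym same-colour)))
    where
    same-colour : colour s ≡ colour s'
    same-colour = cong proj₁ same

  enumerate-slices : Fin ((2 + n) * (2 * 2)) ↣ Slice
  enumerate-slices = ↔⇒↣ ((↔-id _ ×-↔ ((2↔Bool ×-↔ 2↔Bool) ↔-∘ *↔×)) ↔-∘ *↔×)

  encode-keys : (Fin (3 + n) × Bool) ↣ Fin ((3 + n) * 2)
  encode-keys = ↔⇒↣ (↔-sym ((↔-id _ ×-↔ 2↔Bool) ↔-∘ *↔×))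

  more-slices-than-keys : (3 + n) * 2 < (2 + n) * (2 * 2)
  more-slices-than-keys = +-mono-<-≤ (n≤1+n 7) (*-monoʳ-≤ n (m≤m+n 2 2))

  clash : MonochromaticEdge c
  clash =
    let (s , s' , s≢s' , same) = pigeonhole↣ enumerate-slices encode-keys more-slices-than-keys key
    in fromInj₁ (λ s≡s' → contradiction s≡s' s≢s') (same-key⇒clash-or-≡ s s' same)

colour-on-cylinder? : ∀ {k} (c : Ridge (3 + n) → Fin k) j → Dec (∃ λ R → c (cylinder R) ≡ j)
colour-on-cylinder? c j = any-face? λ R → c (cylinder R) ≟ᶠ j

ridge-colouring-clash : ∀ n (c : Ridge (3 + n) → Fin (3 + n)) → MonochromaticEdge c
ridge-colouring-clash zero    c = cube-edge-colouring-clash c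
ridge-colouring-clash (suc n) c with all? (colour-on-cylinder? c)
... | yes every = EveryColourOnACylinder.clash c every
... | no ¬every =
  let (j , unused) = ¬∀⟶∃¬ _ _ (colour-on-cylinder? c) ¬every
      open MissingColour c {j} (λ R hit → unused (R , hit))
  in restriction-clash⇒clash (ridge-colouring-clash n restriction)

theorem2 : (d : ℕ) → d ≥ 3 → (A : Fin d → RidgeUnion d) →
    IsRidgeCover d A → ∃ λ (i : Fin d) → HasAntipodalPair (A i)
theorem2 1 (s≤s ())
theorem2 2 (s≤s (s≤s ()))
theorem2 (suc (suc (suc n))) _ A cover =
  let (R , R' , opp , same) = ridge-colouring-clash n (proj₁ ∘ cover)
      (u , v , antipodal , u∈R , v∈R') = opposable⇒antipodal-pair {w = proj₁ R} {proj₁ R'} opp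
  in proj₁ (cover R) , u , v , antipodal , (R , proj₂ (cover R) , u∈R) ,
     (R' , subst (λ i → A i R') (sym same) (proj₂ (cover R')) , v∈R')
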